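{- No $(r,c)$-graph exists for $(r,c) \in \{(3,2), (4,5), (5,9), (6,13), (6,14)\}$.
   Context: All graphs are finite and simple. For a vertex $v$, $e(v)$ denotes the number of edges of the subgraph induced by the open neighbourhood of $v$. An $(r,c)$-graph is an $r$-regular graph with $e(v) = c$ for every vertex $v$. -}

module Defs where

open import Data.Nat using (ℕ; zero; suc; _+_; _<_)
open import Data.Bool using (Bool; true; false; _∧_)
open import Data.Fin using (Fin; toℕ)
open import Data.List using (List; length; filter; allFin; concatMap; map)
open import Data.Product using (_×_; _,_; proj₁; proj₂)
open import Relation.Binary.PropositionalEquality using (_≡_)
open import Relation.Nullary using (¬_)
open import Data.Nat using (_<ᵇ_)

record SimpleGraph (n : ℕ) : Set where
  field
    adj   : Fin n → Fin n → Bool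
    sym   : ∀ u v → adj u v ≡ adj v u
    irrefl : ∀ v → adj v v ≡ false

open SimpleGraph public

degree : ∀ {n} → SimpleGraph n → Fin n → ℕ
degree {n} G v = length (filter (λ u → adj G v u Data.Bool.≟ true) (allFin n))

pairs : (n : ℕ) → List (Fin n × Fin n)
pairs n = filter (λ p → toℕ (proj₁ p) Data.Nat.<? toℕ (proj₂ p))
                 (concatMap (λ u → map (λ w → (u , w)) (allFin n)) (allFin n))

-- e(v): number of edges of the subgraph induced by the open neighbourhood of v
e : ∀ {n} → SimpleGraph n → Fin n → ℕ
e {n} G v = length (filter (λ p → (adj G v (proj₁ p) ∧ adj G v (proj₂ p) ∧ adj G (proj₁ p) (proj₂ p)) Data.Bool.≟ true) (pairs n))

IsRCGraph : ∀ {n} → SimpleGraph n → ℕ → ℕ → Set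
IsRCGraph {n} G r c = ∀ v → degree G v ≡ r × e G v ≡ c

{-# OPTIONS --safe #-}
module Submission where

-- Let k(v) be the number of ordered pairs of distinct non-adjacent neighbours of v.
-- Sorting the deg(v)² ordered pairs of neighbours of v into adjacent, non-adjacent and
-- equal ones gives deg(v)² = 2e(v) + k(v) + deg(v), so in an (r,c)-graph k = r² - r - 2c
-- at every vertex.  Suppose k > 0 and let x, y be non-adjacent neighbours of v.  Since
-- |N[x]| = |N[v]| and y ∈ N[v] ∖ N[x], some neighbour z of x lies outside N[v].  Every
-- neighbour u of v either has a neighbour in N(v) ∖ N[u], or is a common neighbour of v
-- and x not adjacent to z; writing C for the set of the latter, r ≤ k + |C|.  Inside N(x)
-- the vertex z is non-adjacent to v and to every vertex of C, so 2(1 + |C|) ≤ k.  Hence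
-- 2(r + 1) ≤ 3k, which fails for each of the five parameter pairs.

open import Defs hiding (sym)
open import Data.Bool as Bool using (Bool; true; false; _∧_; _∨_; not)
open import Data.Bool.Properties
  using (∨-zeroʳ; ∨-conicalʳ; ∧-conicalˡ; ∧-conicalʳ; not-¬; not-injective)
open import Data.Fin using (Fin; zero; suc; toℕ; _≟_; punchIn)
open import Data.Fin.Properties using (¬∀⟶∃¬; toℕ-injective)
open import Data.List using (List; []; _∷_; _++_; length; filter; allFin; concatMap; map; tabulate)
open import Data.List.Properties using (map-++; map-tabulate; map-∘)
open import Data.Nat using (ℕ; zero; suc; _+_; _*_; _≤_; _<_; z≤n; s≤s; _≤?_; _<?_)
open import Data.Nat.Properties hiding (_≟_)
import Data.Nat.ListAction as List
open import Data.Nat.ListAction.Properties using (sum-++)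
open import Data.Product using (_×_; _,_; ∃; map₂; proj₁; proj₂)
open import Data.Sum using (_⊎_; inj₁; inj₂)
open import Data.Vec.Functional using (removeAt)
open import Function using (_∘_; id)
open import Relation.Unary using (Decidable)
open import Relation.Binary.PropositionalEquality
open import Relation.Binary using (tri<; tri≈; tri>)
open import Relation.Nullary using (¬_; yes; no; does; contradiction)
open import Relation.Nullary.Decidable using (dec-true; dec-false)
open import Algebra.Properties.Semiring.Sum +-*-semiring
  using ( sum; sum-cong-≗; sum-replicate-zero; sum-remove; ∑-distrib-+; ∑-comm
        ; *-distribˡ-sum; *-distribʳ-sum)

⟦_⟧ : Bool → ℕ
⟦ true ⟧ = 1
⟦ false ⟧ = 0

⟦⟧-∧ : ∀ a b → ⟦ a ∧ b ⟧ ≡ ⟦ a ⟧ * ⟦ b ⟧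
⟦⟧-∧ true b = sym (+-identityʳ ⟦ b ⟧)
⟦⟧-∧ false b = refl

⟦⟧-pos : ∀ {b} → 0 < ⟦ b ⟧ → b ≡ true
⟦⟧-pos {true} _ = refl

⟦⟧-≰ : ∀ {a b} → ¬ ⟦ a ⟧ ≤ ⟦ b ⟧ → a ≡ true × b ≡ false
⟦⟧-≰ {true} {false} _ = refl , refl
⟦⟧-≰ {true} {true} 1≰1 = contradiction ≤-refl 1≰1
⟦⟧-≰ {false} 0≰ = contradiction z≤n 0≰

⟦does-≟true⟧ : ∀ b → ⟦ does (b Bool.≟ true) ⟧ ≡ ⟦ b ⟧
⟦does-≟true⟧ true = refl
⟦does-≟true⟧ false = refl

does-≟-sym : ∀ {n} (u y : Fin n) → does (u ≟ y) ≡ does (y ≟ u)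
does-≟-sym u y with u ≟ y | y ≟ u
... | yes _   | yes _   = refl
... | no _    | no _    = refl
... | yes u≡y | no y≢u  = contradiction (sym u≡y) y≢u
... | no u≢y  | yes y≡u = contradiction (sym y≡u) u≢y

∑-mono-≤ : ∀ {n} {f g : Fin n → ℕ} → (∀ i → f i ≤ g i) → sum f ≤ sum g
∑-mono-≤ {zero} _ = z≤n
∑-mono-≤ {suc n} f≤g = +-mono-≤ (f≤g zero) (∑-mono-≤ (f≤g ∘ suc))

∑-mono-< : ∀ {n} {f g : Fin n → ℕ} {j} → (∀ i → f i ≤ g i) → f j < g j → sum f < sum g
∑-mono-< {suc n} {f} {g} {j} f≤g fj<gj = begin-strict
  sum f                         ≡⟨ sum-remove f ⟩
  f j + sum (removeAt f j)      <⟨ +-mono-<-≤ fj<gj (∑-mono-≤ (f≤g ∘ punchIn j)) ⟩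
  g j + sum (removeAt g j)      ≡⟨ sum-remove g ⟨
  sum g                         ∎
  where
  open ≤-Reasoning

term≤∑ : ∀ {n} (f : Fin n → ℕ) i → f i ≤ sum f
term≤∑ {suc n} f i = ≤-trans (m≤m+n (f i) _) (≤-reflexive (sym (sum-remove f)))

∑-pos : ∀ {n} (f : Fin n → ℕ) → 0 < sum f → ∃ λ i → 0 < f i
∑-pos {suc n} f 0<∑ with 0 <? f zero
... | yes 0<f₀ = zero , 0<f₀
... | no 0≮f₀ with ∑-pos (f ∘ suc) (≤-trans 0<∑ (+-monoˡ-≤ _ (≮⇒≥ 0≮f₀)))
...   | i , 0<fᵢ = suc i , 0<fᵢ

∑-δ : ∀ {n} (a : Fin n) (f : Fin n → ℕ) → sum (λ i → ⟦ does (a ≟ i) ⟧ * f i) ≡ f a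
∑-δ {suc n} zero f = trans (cong₂ _+_ (*-identityˡ (f zero)) (sum-replicate-zero n)) (+-identityʳ (f zero))
∑-δ {suc n} (suc a) f = ∑-δ a (f ∘ suc)

∑-δ≡1 : ∀ {n} (a : Fin n) → sum (λ i → ⟦ does (a ≟ i) ⟧) ≡ 1
∑-δ≡1 {n} a = trans (sum-cong-≗ {n} (λ i → sym (*-identityʳ _))) (∑-δ a (λ _ → 1))

card-≤⇒∃-outside : ∀ {n} (P Q : Fin n → Bool) {w} →
  sum (⟦_⟧ ∘ P) ≤ sum (⟦_⟧ ∘ Q) → P w ≡ true → Q w ≡ false →
  ∃ λ y → Q y ≡ true × P y ≡ false
card-≤⇒∃-outside {n} P Q {w} |P|≤|Q| Pw Qw =
  map₂ ⟦⟧-≰ (¬∀⟶∃¬ n (λ y → ⟦ Q y ⟧ ≤ ⟦ P y ⟧) (λ y → ⟦ Q y ⟧ ≤? ⟦ P y ⟧) Q⊈P)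
  where
  Q⊈P : ¬ (∀ y → ⟦ Q y ⟧ ≤ ⟦ P y ⟧)
  Q⊈P Q⊆P = <⇒≱ (∑-mono-< {j = w} Q⊆P Qw<Pw) |P|≤|Q|
    where
    Qw<Pw : ⟦ Q w ⟧ < ⟦ P w ⟧
    Qw<Pw rewrite Qw | Pw = ≤-refl

∑∑ : ∀ {n} → (Fin n → Fin n → ℕ) → ℕ
∑∑ f = sum (λ u → sum (f u))

∑∑-distrib-+ : ∀ {n} (f g : Fin n → Fin n → ℕ) → ∑∑ (λ u y → f u y + g u y) ≡ ∑∑ f + ∑∑ g
∑∑-distrib-+ {n} f g =
  trans (sum-cong-≗ {n} (λ u → ∑-distrib-+ (f u) (g u))) (∑-distrib-+ (sum ∘ f) (sum ∘ g))

∑∑-row+column≤ : ∀ {n} (f : Fin n → Fin n → ℕ) z → f z z ≡ 0 →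
  sum (f z) + sum (λ u → f u z) ≤ ∑∑ f
∑∑-row+column≤ {n} f z fzz≡0 = begin
  sum (f z) + sum (λ u → f u z)
    ≡⟨ cong₂ _+_ (∑-δ z (sum ∘ f)) (sum-cong-≗ {n} (λ u → ∑-δ z (f u))) ⟨
  sum (λ u → ⟦ does (z ≟ u) ⟧ * sum (f u)) + ∑∑ (λ u y → ⟦ does (z ≟ y) ⟧ * f u y)
    ≡⟨ cong (_+ ∑∑ (λ u y → ⟦ does (z ≟ y) ⟧ * f u y))
            (sum-cong-≗ {n} (λ u → *-distribˡ-sum ⟦ does (z ≟ u) ⟧ (f u))) ⟩
  ∑∑ (λ u y → ⟦ does (z ≟ u) ⟧ * f u y) + ∑∑ (λ u y → ⟦ does (z ≟ y) ⟧ * f u y)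
    ≡⟨ ∑∑-distrib-+ (λ u y → ⟦ does (z ≟ u) ⟧ * f u y) (λ u y → ⟦ does (z ≟ y) ⟧ * f u y) ⟨
  ∑∑ (λ u y → ⟦ does (z ≟ u) ⟧ * f u y + ⟦ does (z ≟ y) ⟧ * f u y)
    ≤⟨ ∑-mono-≤ (λ u → ∑-mono-≤ (pointwise u)) ⟩
  ∑∑ f ∎
  where
  open ≤-Reasoning
  pointwise : ∀ u y → ⟦ does (z ≟ u) ⟧ * f u y + ⟦ does (z ≟ y) ⟧ * f u y ≤ f u y
  pointwise u y with z ≟ u | z ≟ y
  ... | yes refl | yes refl rewrite fzz≡0 = z≤n
  ... | yes refl | no _ = ≤-reflexive (trans (+-identityʳ _) (*-identityˡ _))
  ... | no _ | yes refl = ≤-reflexive (*-identityˡ _)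
  ... | no _ | no _ = z≤n

∑∑-symmetric : ∀ {n} (f : Fin n → Fin n → ℕ) → (∀ u y → f u y ≡ f y u) → (∀ u → f u u ≡ 0) →
  ∑∑ f ≡ 2 * ∑∑ (λ u y → ⟦ does (toℕ u <? toℕ y) ⟧ * f u y)
∑∑-symmetric {n} f f-sym f-hollow = begin
  ∑∑ f                                  ≡⟨ sum-cong-≗ {n} (λ u → sum-cong-≗ {n} (split u)) ⟩
  ∑∑ (λ u y → upper u y + upper y u)    ≡⟨ ∑∑-distrib-+ upper (λ u y → upper y u) ⟩
  ∑∑ upper + ∑∑ (λ u y → upper y u)     ≡⟨ cong (∑∑ upper +_) (∑-comm (λ y u → upper y u)) ⟨
  ∑∑ upper + ∑∑ upper                   ≡⟨ cong (∑∑ upper +_) (+-identityʳ (∑∑ upper)) ⟨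
  2 * ∑∑ upper                          ∎
  where
  open ≡-Reasoning
  upper : Fin n → Fin n → ℕ
  upper u y = ⟦ does (toℕ u <? toℕ y) ⟧ * f u y
  split : ∀ u y → f u y ≡ upper u y + upper y u
  -- `does (m <? n)` computes to `m <ᵇ n`, so `with` cannot abstract it; rewrite instead.
  split u y with <-cmp (toℕ u) (toℕ y)
  ... | tri< u<y _ y≮u rewrite dec-true (toℕ u <? toℕ y) u<y | dec-false (toℕ y <? toℕ u) y≮u
    = sym (trans (+-identityʳ _) (*-identityˡ _))
  ... | tri> u≮y _ y<u rewrite dec-false (toℕ u <? toℕ y) u≮y | dec-true (toℕ y <? toℕ u) y<u
    = trans (f-sym u y) (sym (*-identityˡ _))
  ... | tri≈ u≮y u≡y y≮u rewrite dec-false (toℕ u <? toℕ y) u≮y | dec-false (toℕ y <? toℕ u) y≮u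
    = trans (cong (f u) (sym (toℕ-injective u≡y))) (f-hollow u)

module _ {A : Set} where

  length-filter≡sum : ∀ {P : A → Set} (P? : Decidable P) xs →
    length (filter P? xs) ≡ List.sum (map (λ x → ⟦ does (P? x) ⟧) xs)
  length-filter≡sum P? [] = refl
  length-filter≡sum P? (x ∷ xs) with does (P? x)
  ... | true  = cong suc (length-filter≡sum P? xs)
  ... | false = length-filter≡sum P? xs

  sum-map-filter : ∀ {P : A → Set} (P? : Decidable P) (f : A → ℕ) xs →
    List.sum (map f (filter P? xs)) ≡ List.sum (map (λ x → ⟦ does (P? x) ⟧ * f x) xs)
  sum-map-filter P? f [] = refl
  sum-map-filter P? f (x ∷ xs) with does (P? x)
  ... | true  = cong₂ _+_ (sym (+-identityʳ (f x))) (sum-map-filter P? f xs)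
  ... | false = sum-map-filter P? f xs

  sum-map-concatMap : ∀ {B : Set} (f : B → ℕ) (g : A → List B) xs →
    List.sum (map f (concatMap g xs)) ≡ List.sum (map (List.sum ∘ map f ∘ g) xs)
  sum-map-concatMap f g [] = refl
  sum-map-concatMap f g (x ∷ xs) = begin
    List.sum (map f (g x ++ concatMap g xs))
      ≡⟨ cong List.sum (map-++ f (g x) (concatMap g xs)) ⟩
    List.sum (map f (g x) ++ map f (concatMap g xs))
      ≡⟨ sum-++ (map f (g x)) (map f (concatMap g xs)) ⟩
    List.sum (map f (g x)) + List.sum (map f (concatMap g xs))
      ≡⟨ cong (List.sum (map f (g x)) +_) (sum-map-concatMap f g xs) ⟩
    List.sum (map (List.sum ∘ map f ∘ g) (x ∷ xs)) ∎
    where open ≡-Reasoning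

sum-tabulate : ∀ {n} (f : Fin n → ℕ) → List.sum (tabulate f) ≡ sum f
sum-tabulate {zero} f = refl
sum-tabulate {suc n} f = cong (f zero +_) (sum-tabulate (f ∘ suc))

sum-map-allFin : ∀ n (f : Fin n → ℕ) → List.sum (map f (allFin n)) ≡ sum f
sum-map-allFin n f = trans (cong List.sum (map-tabulate id f)) (sum-tabulate f)

sum-map-allPairs : ∀ n (f : Fin n × Fin n → ℕ) →
  List.sum (map f (concatMap (λ u → map (u ,_) (allFin n)) (allFin n))) ≡ ∑∑ (λ u y → f (u , y))
sum-map-allPairs n f = begin
  List.sum (map f (concatMap (λ u → map (u ,_) (allFin n)) (allFin n)))
    ≡⟨ sum-map-concatMap f (λ u → map (u ,_) (allFin n)) (allFin n) ⟩
  List.sum (map (λ u → List.sum (map f (map (u ,_) (allFin n)))) (allFin n))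
    ≡⟨ sum-map-allFin n (λ u → List.sum (map f (map (u ,_) (allFin n)))) ⟩
  sum (λ u → List.sum (map f (map (u ,_) (allFin n))))
    ≡⟨ sum-cong-≗ {n} (λ u → trans (cong List.sum (sym (map-∘ (allFin n))))
                                   (sum-map-allFin n (λ y → f (u , y)))) ⟩
  ∑∑ (λ u y → f (u , y)) ∎
  where open ≡-Reasoning

module _ {n} (G : SimpleGraph n) where

  infix 7 _~_ _∈N[_]

  _~_ : Fin n → Fin n → Bool
  _~_ = adj G

  _∈N[_] : Fin n → Fin n → Bool
  y ∈N[ a ] = does (a ≟ y) ∨ a ~ y

  triangle : Fin n → Fin n → Fin n → Bool
  triangle v u y = v ~ u ∧ v ~ y ∧ u ~ y

  -- Ordered: each non-edge of the neighbourhood of v is counted twice by missingEdges v.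
  missingEdge : Fin n → Fin n → Fin n → Bool
  missingEdge v u y = v ~ u ∧ v ~ y ∧ not (y ∈N[ u ])

  missingEdges : Fin n → ℕ
  missingEdges v = ∑∑ (λ u y → ⟦ missingEdge v u y ⟧)

  privateNeighbour : Fin n → Fin n → Fin n → Bool
  privateNeighbour a b y = b ~ y ∧ not (y ∈N[ a ])

  privateNeighbours : Fin n → Fin n → ℕ
  privateNeighbours a b = sum (λ y → ⟦ privateNeighbour a b y ⟧)

  ~-sym : ∀ {u y b} → u ~ y ≡ b → y ~ u ≡ b
  ~-sym {u} {y} = trans (SimpleGraph.sym G y u)

  ∈N-sym : ∀ a y → y ∈N[ a ] ≡ a ∈N[ y ]
  ∈N-sym a y = cong₂ _∨_ (does-≟-sym a y) (SimpleGraph.sym G a y)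

  ∈N-split : ∀ a y → ⟦ y ∈N[ a ] ⟧ ≡ ⟦ does (a ≟ y) ⟧ + ⟦ a ~ y ⟧
  ∈N-split a y with a ≟ y
  ... | yes refl rewrite irrefl G a = refl
  ... | no _ = refl

  ~⇒∈N : ∀ {a y} → a ~ y ≡ true → y ∈N[ a ] ≡ true
  ~⇒∈N {a} {y} a~y rewrite a~y = ∨-zeroʳ (does (a ≟ y))

  ∈N⇒~ : ∀ {a y} → y ∈N[ a ] ≡ true → a ≢ y → a ~ y ≡ true
  ∈N⇒~ {a} {y} y∈N[a] a≢y = trans (cong (_∨ a ~ y) (sym (dec-false (a ≟ y) a≢y))) y∈N[a]

  ∉N⇒≁ : ∀ {a y} → y ∈N[ a ] ≡ false → a ~ y ≡ false
  ∉N⇒≁ {a} {y} = ∨-conicalʳ (does (a ≟ y)) (a ~ y)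

  degree≡∑ : ∀ v → degree G v ≡ sum (λ u → ⟦ v ~ u ⟧)
  degree≡∑ v = begin
    degree G v
      ≡⟨ length-filter≡sum (λ u → v ~ u Bool.≟ true) (allFin n) ⟩
    List.sum (map (λ u → ⟦ does (v ~ u Bool.≟ true) ⟧) (allFin n))
      ≡⟨ sum-map-allFin n _ ⟩
    sum (λ u → ⟦ does (v ~ u Bool.≟ true) ⟧)
      ≡⟨ sum-cong-≗ {n} (λ u → ⟦does-≟true⟧ (v ~ u)) ⟩
    sum (λ u → ⟦ v ~ u ⟧) ∎
    where open ≡-Reasoning

  triangle-sym : ∀ v u y → ⟦ triangle v u y ⟧ ≡ ⟦ triangle v y u ⟧
  triangle-sym v u y with v ~ u | v ~ y
  ... | true  | true  = cong ⟦_⟧ (SimpleGraph.sym G u y)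
  ... | true  | false = refl
  ... | false | true  = refl
  ... | false | false = refl

  triangle-hollow : ∀ v u → ⟦ triangle v u u ⟧ ≡ 0
  triangle-hollow v u rewrite irrefl G u with v ~ u
  ... | true  = refl
  ... | false = refl

  ∑∑-triangle : ∀ v → ∑∑ (λ u y → ⟦ triangle v u y ⟧) ≡ 2 * e G v
  ∑∑-triangle v = begin
    ∑∑ (λ u y → ⟦ triangle v u y ⟧)                  ≡⟨ ∑∑-symmetric _ (triangle-sym v) (triangle-hollow v) ⟩
    2 * ∑∑ (λ u y → ⟦ u <ᵇ y ⟧ * ⟦ triangle v u y ⟧) ≡⟨ cong (2 *_) upper≡e ⟨
    2 * e G v                                        ∎
    where
    open ≡-Reasoning
    _<ᵇ_ : Fin n → Fin n → Bool
    u <ᵇ y = does (toℕ u <? toℕ y)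
    isTriangle : Fin n × Fin n → ℕ
    isTriangle (u , y) = ⟦ does (triangle v u y Bool.≟ true) ⟧
    allPairs : List (Fin n × Fin n)
    allPairs = concatMap (λ u → map (u ,_) (allFin n)) (allFin n)
    upper≡e : e G v ≡ ∑∑ (λ u y → ⟦ u <ᵇ y ⟧ * ⟦ triangle v u y ⟧)
    upper≡e = begin
      e G v ≡⟨ length-filter≡sum (λ p → triangle v (proj₁ p) (proj₂ p) Bool.≟ true) (pairs n) ⟩
      List.sum (map isTriangle (pairs n))
        ≡⟨ sum-map-filter (λ p → toℕ (proj₁ p) <? toℕ (proj₂ p)) isTriangle allPairs ⟩
      List.sum (map (λ p → ⟦ proj₁ p <ᵇ proj₂ p ⟧ * isTriangle p) allPairs)
        ≡⟨ sum-map-allPairs n (λ p → ⟦ proj₁ p <ᵇ proj₂ p ⟧ * isTriangle p) ⟩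
      ∑∑ (λ u y → ⟦ u <ᵇ y ⟧ * ⟦ does (triangle v u y Bool.≟ true) ⟧)
        ≡⟨ sum-cong-≗ {n} (λ u → sum-cong-≗ {n} λ y →
             cong (⟦ u <ᵇ y ⟧ *_) (⟦does-≟true⟧ (triangle v u y))) ⟩
      ∑∑ (λ u y → ⟦ u <ᵇ y ⟧ * ⟦ triangle v u y ⟧) ∎

  neighbourPair-split : ∀ v u y →
    ⟦ v ~ u ⟧ * ⟦ v ~ y ⟧ ≡ ⟦ triangle v u y ⟧ + ⟦ missingEdge v u y ⟧ + ⟦ does (u ≟ y) ⟧ * ⟦ v ~ y ⟧
  neighbourPair-split v u y with u ≟ y
  ... | yes refl rewrite irrefl G u with v ~ u
  ...   | true  = refl
  ...   | false = refl
  neighbourPair-split v u y | no _ with v ~ u | v ~ y | u ~ y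
  ...   | true  | true  | true  = refl
  ...   | true  | true  | false = refl
  ...   | true  | false | _     = refl
  ...   | false | _     | _     = refl

  degree-square : ∀ v → degree G v * degree G v ≡ missingEdges v + (2 * e G v + degree G v)
  degree-square v = begin
    degree G v * degree G v
      ≡⟨ cong₂ _*_ (degree≡∑ v) (degree≡∑ v) ⟩
    sum (λ u → ⟦ v ~ u ⟧) * sum (λ y → ⟦ v ~ y ⟧)
      ≡⟨ *-distribʳ-sum (sum (λ y → ⟦ v ~ y ⟧)) (λ u → ⟦ v ~ u ⟧) ⟩
    sum (λ u → ⟦ v ~ u ⟧ * sum (λ y → ⟦ v ~ y ⟧))
      ≡⟨ sum-cong-≗ {n} (λ u → *-distribˡ-sum ⟦ v ~ u ⟧ (λ y → ⟦ v ~ y ⟧)) ⟩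
    ∑∑ (λ u y → ⟦ v ~ u ⟧ * ⟦ v ~ y ⟧)
      ≡⟨ sum-cong-≗ {n} (λ u → sum-cong-≗ {n} (neighbourPair-split v u)) ⟩
    ∑∑ (λ u y → ⟦ triangle v u y ⟧ + ⟦ missingEdge v u y ⟧ + ⟦ does (u ≟ y) ⟧ * ⟦ v ~ y ⟧)
      ≡⟨ ∑∑-distrib-+ (λ u y → ⟦ triangle v u y ⟧ + ⟦ missingEdge v u y ⟧)
                      (λ u y → ⟦ does (u ≟ y) ⟧ * ⟦ v ~ y ⟧) ⟩
    ∑∑ (λ u y → ⟦ triangle v u y ⟧ + ⟦ missingEdge v u y ⟧)
      + ∑∑ (λ u y → ⟦ does (u ≟ y) ⟧ * ⟦ v ~ y ⟧)
      ≡⟨ cong₂ _+_ (∑∑-distrib-+ (λ u y → ⟦ triangle v u y ⟧) (λ u y → ⟦ missingEdge v u y ⟧))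
                   (sum-cong-≗ {n} (λ u → ∑-δ u (λ y → ⟦ v ~ y ⟧))) ⟩
    ∑∑ (λ u y → ⟦ triangle v u y ⟧) + missingEdges v + sum (λ u → ⟦ v ~ u ⟧)
      ≡⟨ cong₂ _+_ (cong (_+ missingEdges v) (sym (∑∑-triangle v))) (degree≡∑ v) ⟨
    2 * e G v + missingEdges v + degree G v
      ≡⟨ cong (_+ degree G v) (+-comm (2 * e G v) (missingEdges v)) ⟩
    missingEdges v + 2 * e G v + degree G v
      ≡⟨ +-assoc (missingEdges v) (2 * e G v) (degree G v) ⟩
    missingEdges v + (2 * e G v + degree G v) ∎
    where open ≡-Reasoning

  missingEdge-sym : ∀ v u y → missingEdge v u y ≡ missingEdge v y u
  missingEdge-sym v u y with v ~ u | v ~ y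
  ... | true  | true  = cong not (cong₂ _∨_ (does-≟-sym u y) (SimpleGraph.sym G u y))
  ... | true  | false = refl
  ... | false | true  = refl
  ... | false | false = refl

  missingEdge-hollow : ∀ v u → missingEdge v u u ≡ false
  missingEdge-hollow v u rewrite dec-true (u ≟ u) refl with v ~ u
  ... | true  = refl
  ... | false = refl

  missingEdge-true : ∀ {v u y} → missingEdge v u y ≡ true → v ~ u ≡ true × v ~ y ≡ true × y ∈N[ u ] ≡ false
  missingEdge-true {v} {u} {y} m≡true =
    ∧-conicalˡ (v ~ u) (v ~ y ∧ not (y ∈N[ u ])) m≡true ,
    ∧-conicalˡ (v ~ y) (not (y ∈N[ u ])) rest ,
    not-injective (∧-conicalʳ (v ~ y) (not (y ∈N[ u ])) rest)
    where
    rest : v ~ y ∧ not (y ∈N[ u ]) ≡ true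
    rest = ∧-conicalʳ (v ~ u) (v ~ y ∧ not (y ∈N[ u ])) m≡true

  missingEdges≡∑privateNeighbours : ∀ v → missingEdges v ≡ sum (λ u → ⟦ v ~ u ⟧ * privateNeighbours u v)
  missingEdges≡∑privateNeighbours v = sum-cong-≗ {n} λ u →
    trans (sum-cong-≗ {n} (λ y → ⟦⟧-∧ (v ~ u) (privateNeighbour u v y)))
          (sym (*-distribˡ-sum ⟦ v ~ u ⟧ (λ y → ⟦ privateNeighbour u v y ⟧)))

  privateNeighbour⇒pos : ∀ {a b y} → b ~ y ≡ true → y ∈N[ a ] ≡ false → 0 < privateNeighbours a b
  privateNeighbour⇒pos {a} {b} {y} b~y y∉N[a] =
    ≤-trans (≤-reflexive (cong ⟦_⟧ (sym is-private))) (term≤∑ _ y)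
    where
    is-private : privateNeighbour a b y ≡ true
    is-private rewrite b~y | y∉N[a] = refl

  module _ {r} (regular : ∀ v → degree G v ≡ r) where

    closedNeighbourhood-size : ∀ a → sum (λ y → ⟦ y ∈N[ a ] ⟧) ≡ suc r
    closedNeighbourhood-size a = begin
      sum (λ y → ⟦ y ∈N[ a ] ⟧)
        ≡⟨ sum-cong-≗ {n} (∈N-split a) ⟩
      sum (λ y → ⟦ does (a ≟ y) ⟧ + ⟦ a ~ y ⟧)
        ≡⟨ ∑-distrib-+ (λ y → ⟦ does (a ≟ y) ⟧) (λ y → ⟦ a ~ y ⟧) ⟩
      sum (λ y → ⟦ does (a ≟ y) ⟧) + sum (λ y → ⟦ a ~ y ⟧)
        ≡⟨ cong₂ _+_ (∑-δ≡1 a) (trans (sym (degree≡∑ a)) (regular a)) ⟩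
      suc r ∎
      where open ≡-Reasoning

    privateNeighbour-exists : ∀ {a b w} → a ~ b ≡ true → a ~ w ≡ true → w ∈N[ b ] ≡ false →
      ∃ λ y → b ~ y ≡ true × y ∈N[ a ] ≡ false
    privateNeighbour-exists {a} {b} {w} a~b a~w w∉N[b] =
      let y , y∈N[b] , y∉N[a] = card-≤⇒∃-outside (_∈N[ a ]) (_∈N[ b ]) same-size (~⇒∈N a~w) w∉N[b]
      in y , ∈N⇒~ y∈N[b] (b≢y y∉N[a]) , y∉N[a]
      where
      same-size : sum (λ y → ⟦ y ∈N[ a ] ⟧) ≤ sum (λ y → ⟦ y ∈N[ b ] ⟧)
      same-size = ≤-reflexive (trans (closedNeighbourhood-size a) (sym (closedNeighbourhood-size b)))
      b≢y : ∀ {y} → y ∈N[ a ] ≡ false → b ≢ y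
      b≢y y∉N[a] refl = not-¬ y∉N[a] (~⇒∈N a~b)

    privateNeighbours-pos : ∀ {a b w} → a ~ b ≡ true → a ~ w ≡ true → w ∈N[ b ] ≡ false →
      0 < privateNeighbours a b
    privateNeighbours-pos a~b a~w w∉N[b] =
      let _ , b~y , y∉N[a] = privateNeighbour-exists a~b a~w w∉N[b] in privateNeighbour⇒pos b~y y∉N[a]

    module _ {v x z} (v~x : v ~ x ≡ true) (x~z : x ~ z ≡ true) (z∉N[v] : z ∈N[ v ] ≡ false) where

      common : Fin n → Bool
      common u = v ~ u ∧ x ~ u ∧ not (z ~ u)

      #common : ℕ
      #common = sum (λ u → ⟦ common u ⟧)

      private-or-common : ∀ u → v ~ u ≡ true → 1 ≤ privateNeighbours u v + ⟦ x ~ u ∧ not (z ~ u) ⟧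
      private-or-common u v~u with z ~ u in z~u | x ~ u in x~u
      ... | true  | _     = ≤-trans (privateNeighbours-pos (~-sym v~u) (~-sym z~u) z∉N[v]) (m≤m+n _ _)
      ... | false | true  = m≤n+m 1 _
      ... | false | false = ≤-trans (privateNeighbour⇒pos v~x x∉N[u]) (m≤m+n _ _)
        where
        x∉N[u] : x ∈N[ u ] ≡ false
        x∉N[u] = cong₂ _∨_ (dec-false (u ≟ x) (λ { refl → not-¬ z~u (~-sym x~z) })) (~-sym x~u)

      neighbour-covered : ∀ u → ⟦ v ~ u ⟧ ≤ ⟦ v ~ u ⟧ * privateNeighbours u v + ⟦ common u ⟧
      neighbour-covered u with v ~ u in v~u
      ... | false = z≤n
      ... | true  = ≤-trans (private-or-common u v~u) (≤-reflexive (cong (_+ ⟦ x ~ u ∧ not (z ~ u) ⟧)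
                                                                  (sym (*-identityˡ (privateNeighbours u v)))))

      degree≤missingEdges+#common : r ≤ missingEdges v + #common
      degree≤missingEdges+#common = begin
        r
          ≡⟨ trans (sym (regular v)) (degree≡∑ v) ⟩
        sum (λ u → ⟦ v ~ u ⟧)
          ≤⟨ ∑-mono-≤ neighbour-covered ⟩
        sum (λ u → ⟦ v ~ u ⟧ * privateNeighbours u v + ⟦ common u ⟧)
          ≡⟨ ∑-distrib-+ (λ u → ⟦ v ~ u ⟧ * privateNeighbours u v) (λ u → ⟦ common u ⟧) ⟩
        sum (λ u → ⟦ v ~ u ⟧ * privateNeighbours u v) + #common
          ≡⟨ cong (_+ #common) (missingEdges≡∑privateNeighbours v) ⟨
        missingEdges v + #common ∎
        where open ≤-Reasoning

      z≢neighbour : ∀ {y} → v ~ y ≡ true → z ≢ y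
      z≢neighbour v~y refl = not-¬ (∉N⇒≁ z∉N[v]) v~y

      v-or-common⇒missingEdge : ∀ y → ⟦ does (v ≟ y) ⟧ + ⟦ common y ⟧ ≤ ⟦ missingEdge x z y ⟧
      v-or-common⇒missingEdge y with v ≟ y
      ... | yes refl rewrite irrefl G v | x~z | ~-sym v~x | trans (∈N-sym z v) z∉N[v] = ≤-refl
      ... | no _ with v ~ y in v~y | x ~ y | z ~ y
      ...   | true  | true  | false rewrite x~z | dec-false (z ≟ y) (z≢neighbour v~y) = ≤-refl
      ...   | true  | true  | true  = z≤n
      ...   | true  | false | _     = z≤n
      ...   | false | _     | _     = z≤n

      2*suc-#common≤missingEdges : 2 * suc #common ≤ missingEdges x
      2*suc-#common≤missingEdges = begin
        2 * suc #common            ≡⟨ cong (suc #common +_) (+-identityʳ (suc #common)) ⟩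
        suc #common + suc #common  ≤⟨ +-mono-≤ ≤row (≤-trans ≤row (≤-reflexive row≡column)) ⟩
        row + column               ≤⟨ ∑∑-row+column≤ (λ u y → ⟦ missingEdge x u y ⟧) z
                                                      (cong ⟦_⟧ (missingEdge-hollow x z)) ⟩
        missingEdges x             ∎
        where
        open ≤-Reasoning
        row column : ℕ
        row    = sum (λ y → ⟦ missingEdge x z y ⟧)
        column = sum (λ u → ⟦ missingEdge x u z ⟧)
        row≡column : row ≡ column
        row≡column = sum-cong-≗ {n} (λ y → cong ⟦_⟧ (missingEdge-sym x z y))
        ≤row : suc #common ≤ row
        ≤row = begin
          suc #common
            ≡⟨ cong (_+ #common) (∑-δ≡1 v) ⟨
          sum (λ y → ⟦ does (v ≟ y) ⟧) + #common
            ≡⟨ ∑-distrib-+ (λ y → ⟦ does (v ≟ y) ⟧) (λ y → ⟦ common y ⟧) ⟨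
          sum (λ y → ⟦ does (v ≟ y) ⟧ + ⟦ common y ⟧)
            ≤⟨ ∑-mono-≤ v-or-common⇒missingEdge ⟩
          row ∎

    missingEdges-bound : ∀ {K v} → (∀ w → missingEdges w ≤ K) → 0 < missingEdges v → 2 * suc r ≤ 3 * K
    missingEdges-bound {K} {v} ≤K 0<M
      with x , 0<row ← ∑-pos (λ u → sum (λ y → ⟦ missingEdge v u y ⟧)) 0<M
      with y , 0<⟦⟧ ← ∑-pos (λ y → ⟦ missingEdge v x y ⟧) 0<row
      with v~x , v~y , y∉N[x] ← missingEdge-true (⟦⟧-pos 0<⟦⟧)
      with z , x~z , z∉N[v] ← privateNeighbour-exists v~x v~y y∉N[x]
      = combine (degree≤missingEdges+#common v~x x~z z∉N[v])
                (2*suc-#common≤missingEdges v~x x~z z∉N[v])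
                (≤K v) (≤K x)
      where
      combine : ∀ {a t b} → r ≤ a + t → 2 * suc t ≤ b → a ≤ K → b ≤ K → 2 * suc r ≤ 3 * K
      combine {a} {t} r≤a+t 2+2t≤b a≤K b≤K = begin
        2 * suc r           ≤⟨ *-monoʳ-≤ 2 (s≤s r≤a+t) ⟩
        2 * suc (a + t)     ≡⟨ cong (2 *_) (+-suc a t) ⟨
        2 * (a + suc t)     ≡⟨ *-distribˡ-+ 2 a (suc t) ⟩
        2 * a + 2 * suc t   ≤⟨ +-mono-≤ (*-monoʳ-≤ 2 a≤K) (≤-trans 2+2t≤b b≤K) ⟩
        2 * K + K           ≡⟨ +-comm (2 * K) K ⟩
        3 * K               ∎
        where open ≤-Reasoning

-- That is, 2(r + 1) ≤ 3k for k = r² - r - 2c > 0, stated without truncated subtraction.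
RCGraph-bound : ∀ {n} (G : SimpleGraph n) {r c} → IsRCGraph G r c → Fin n → 2 * c + r < r * r →
  2 * suc r + 3 * (2 * c + r) ≤ 3 * (r * r)
RCGraph-bound {n} G {r} {c} isRC v 2c+r<r² = begin
  2 * suc r + 3 * (2 * c + r)  ≤⟨ +-monoˡ-≤ (3 * (2 * c + r)) (missingEdges-bound G regular M≤Mv 0<Mv) ⟩
  3 * M v + 3 * (2 * c + r)    ≡⟨ *-distribˡ-+ 3 (M v) (2 * c + r) ⟨
  3 * (M v + (2 * c + r))      ≡⟨ cong (3 *_) (M+2c+r≡r² v) ⟩
  3 * (r * r)                  ∎
  where
  open ≤-Reasoning
  M : Fin n → ℕ
  M = missingEdges G
  regular : ∀ w → degree G w ≡ r
  regular w = proj₁ (isRC w)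
  M+2c+r≡r² : ∀ w → M w + (2 * c + r) ≡ r * r
  M+2c+r≡r² w = begin-equality
    M w + (2 * c + r)               ≡⟨ cong₂ (λ ε d → M w + (2 * ε + d)) (proj₂ (isRC w)) (regular w) ⟨
    M w + (2 * e G w + degree G w)  ≡⟨ degree-square G w ⟨
    degree G w * degree G w         ≡⟨ cong₂ _*_ (regular w) (regular w) ⟩
    r * r                           ∎
  M≤Mv : ∀ w → M w ≤ M v
  M≤Mv w = ≤-reflexive (+-cancelʳ-≡ (2 * c + r) (M w) (M v)
                                     (trans (M+2c+r≡r² w) (sym (M+2c+r≡r² v))))
  0<Mv : 0 < M v
  0<Mv = +-cancelʳ-< (2 * c + r) 0 (M v) (subst (2 * c + r <_) (sym (M+2c+r≡r² v)) 2c+r<r²)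

proposition4p1 : (r c : ℕ) →
    ((r , c) ≡ (3 , 2) ⊎ (r , c) ≡ (4 , 5) ⊎ (r , c) ≡ (5 , 9) ⊎ (r , c) ≡ (6 , 13) ⊎ (r , c) ≡ (6 , 14)) →
    (n : ℕ) → 0 < n → (G : SimpleGraph n) → ¬ IsRCGraph G r c
proposition4p1 _ _ _ zero ()
proposition4p1 _ _ (inj₁ refl) (suc _) _ G isRC =
  <⇒≱ (≤ᵇ⇒≤ _ _ _) (RCGraph-bound G isRC zero (≤ᵇ⇒≤ _ _ _))
proposition4p1 _ _ (inj₂ (inj₁ refl)) (suc _) _ G isRC =
  <⇒≱ (≤ᵇ⇒≤ _ _ _) (RCGraph-bound G isRC zero (≤ᵇ⇒≤ _ _ _))
proposition4p1 _ _ (inj₂ (inj₂ (inj₁ refl))) (suc _) _ G isRC =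
  <⇒≱ (≤ᵇ⇒≤ _ _ _) (RCGraph-bound G isRC zero (≤ᵇ⇒≤ _ _ _))
proposition4p1 _ _ (inj₂ (inj₂ (inj₂ (inj₁ refl)))) (suc _) _ G isRC =
  <⇒≱ (≤ᵇ⇒≤ _ _ _) (RCGraph-bound G isRC zero (≤ᵇ⇒≤ _ _ _))
proposition4p1 _ _ (inj₂ (inj₂ (inj₂ (inj₂ refl)))) (suc _) _ G isRC =
  <⇒≱ (≤ᵇ⇒≤ _ _ _) (RCGraph-bound G isRC zero (≤ᵇ⇒≤ _ _ _))
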